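{- Let $U$ be a row-strict composition tableau and let $b_1\le b_2\le\cdots\le b_n$ be positive integers. Let $U_n=(\cdots((U\leftarrow b_1)\leftarrow b_2)\cdots)\leftarrow b_n$ and let $B_1,\dots,B_n$ be the new boxes created by the successive insertions of $b_1,\dots,b_n$ (regarded as boxes of $U_n$). Then in $U_n$, \[ B_n<_{col}B_{n-1}<_{col}\cdots<_{col}B_1. \]
   Context: Diagrams: row $i$ of the diagram of a strong composition $\alpha$ has $\alpha_i$ left-justified boxes; $(i,j)$ is row $i$ (from the top), column $j$. A row-strict composition tableau (RCT) of shape $\alpha$ ($k$ parts, largest part $m$) is a filling with positive integers such that the first column weakly increases top to bottom, each row strictly decreases left to right, and (Triple Rule) after padding rows with zeros to a $k\times m$ array $\hat U$, for $1\le i_1<i_2\le k$, $2\le j\le m$: $\hat U(i_2,j)\neq0$ and $\hat U(i_2,j)>\hat U(i_1,j)$ imply $\hat U(i_2,j)\ge\hat U(i_1,j-1)$. RCT insertion $U\leftarrow b$ ($U$ an RCT with longest row length $m$, $b$ a positive integer): scan $U$ column by column from right to left, each column from top to bottom, starting in column $m+1$ with $b$ in hand. (1) In column $m+1$: if the current position is at the end of a row of length $m$ and $b$ is strictly less than the last entry of that row, place $b$ there and stop; otherwise continue at the top of column $m$. (2) Inductively, with entry $b_j$ in hand at the top of column $j$: (a) if the current position is empty, is at the end of a row of length $j-1$, and $b_j$ is strictly less than the last entry of that row, place $b_j$ there and stop; (b) if the current position is nonempty and holds $\tilde b_j\le b_j$ with $b_j$ strictly less than the entry immediately to the left of $\tilde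 b_j$, then $b_j$ replaces (bumps) $\tilde b_j$ and scanning of column $j$ continues with $\tilde b_j$ in hand, bumping whenever possible; after the last entry of column $j$, scanning continues at the top of column $j-1$. (3) If an entry $b_1$ is bumped into the first column, it is placed in a new row of length one that appears directly after the lowest row whose first-column entry is weakly less than $b_1$. The new box of an insertion is the box where it stops (or the box of the new row). A box created at some step is tracked through later insertions (if a later insertion creates a new row above it, it moves down one row). Column reading order: $(i,j)<_{col}(i',j')$ iff $j<j'$, or $j=j'$ and $i>i'$ (columns left to right, each column bottom to top). -}

module Defs where

open import Data.Nat using (ℕ; zero; suc; _+_; _∸_; _≤_; _<_; _⊔_; _<ᵇ_; _≤ᵇ_; _≡ᵇ_)
open import Data.Bool using (Bool; true; false; if_then_else_; _∧_)
open import Data.List using (List; []; _∷_; _++_; length; map; foldr; [_])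
open import Data.List.Relation.Unary.All using (All)
open import Data.List.Relation.Unary.Linked using (Linked)
open import Data.Product using (_×_; _,_; proj₁; proj₂)
open import Data.Sum using (_⊎_)
open import Relation.Binary.PropositionalEquality using (_≡_; _≢_)

-- Tableaux: a list of rows (top to bottom); each row is the list of its
-- entries read left to right.  Rows/columns are 1-indexed in `entry`.

Row : Set
Row = List ℕ

Tableau : Set
Tableau = List Row

get : List ℕ → ℕ → ℕ
get []       _       = 0
get (x ∷ _)  zero    = x
get (_ ∷ xs) (suc n) = get xs n

getRow : Tableau → ℕ → Row
getRow []       _       = []
getRow (r ∷ _)  zero    = r
getRow (_ ∷ rs) (suc n) = getRow rs n

-- padded entry \hat U(i,j), i and j 1-indexed (0 outside the diagram)
entry : Tableau → ℕ → ℕ → ℕ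
entry T i j = get (getRow T (i ∸ 1)) (j ∸ 1)

numRows : Tableau → ℕ
numRows = length

maxLen : Tableau → ℕ
maxLen = foldr (λ r m → length r ⊔ m) 0

firstCol : Tableau → List ℕ
firstCol = map (λ r → get r 0)

record IsRCT (T : Tableau) : Set where
  field
    rowsNonempty  : All (λ r → 1 ≤ length r) T
    positive      : All (All (λ x → 1 ≤ x)) T
    firstColWeak  : Linked _≤_ (firstCol T)
    rowsStrict    : All (Linked (λ x y → y < x)) T
    tripleRule    : ∀ i₁ i₂ j → 1 ≤ i₁ → i₁ < i₂ → i₂ ≤ numRows T →
                    2 ≤ j → j ≤ maxLen T →
                    entry T i₂ j ≢ 0 → entry T i₁ j < entry T i₂ j →
                    entry T i₁ (j ∸ 1) ≤ entry T i₂ j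

-- Boxes (row, column), 1-indexed, and column reading order

Box : Set
Box = ℕ × ℕ

_<col_ : Box → Box → Set
(i , j) <col (i′ , j′) = (j < j′) ⊎ ((j ≡ j′) × (i′ < i))

set : List ℕ → ℕ → ℕ → List ℕ
set []       _       _ = []
set (_ ∷ xs) zero    y = y ∷ xs
set (x ∷ xs) (suc n) y = x ∷ set xs n y

data ScanResult : Set where
  stopAt : Tableau → ℕ → ScanResult      -- placed; row index (1-indexed)
  goOn   : Tableau → ℕ → ScanResult

-- scan column (suc (suc c)) (i.e. column j = c + 2 ≥ 2) top to bottom,
-- with entry x in hand; i = 1-indexed number of the current row
scanCol : ℕ → ℕ → ℕ → Tableau → ScanResult
scanCol c i x [] = goOn [] x
scanCol c i x (r ∷ rs) =
  if (length r ≡ᵇ suc c) ∧ (x <ᵇ get r c)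
  -- (a) empty position at end of a row of length j-1, x < last entry: place
  then stopAt ((r ++ [ x ]) ∷ rs) i
  else (if (suc c <ᵇ length r) ∧ (get r (suc c) ≤ᵇ x) ∧ (x <ᵇ get r c)
  -- (b) nonempty position with entry ≤ x and x < entry to its left: bump
        then cont (set r (suc c) x) (get r (suc c))
        else cont r x)
  where
  cont : Row → ℕ → ScanResult
  cont r′ y with scanCol c (suc i) y rs
  ... | stopAt rs′ k = stopAt (r′ ∷ rs′) k
  ... | goOn rs′ z   = goOn (r′ ∷ rs′) z

data InsResult : Set where
  placed : Tableau → Box → InsResult    -- new box (row, column), column ≥ 2
  newRow : Tableau → ℕ → InsResult      -- new row of length one at this row (1-indexed)

-- 1-indexed number of the lowest row whose first entry is ≤ x (0 if none)
lastLe : ℕ → ℕ → ℕ → Tableau → ℕ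
lastLe x i acc []       = acc
lastLe x i acc (r ∷ rs) = lastLe x (suc i) (if get r 0 ≤ᵇ x then suc i else acc) rs

insertAt : Tableau → ℕ → Row → Tableau
insertAt rs       zero    r = r ∷ rs
insertAt []       (suc n) r = r ∷ []
insertAt (s ∷ rs) (suc n) r = s ∷ insertAt rs n r

makeNewRow : ℕ → Tableau → InsResult
makeNewRow x T = newRow (insertAt T p [ x ]) (suc p)
  where p = lastLe x 0 0 T

-- scan columns k+1, k, ..., 2 (right to left), then the first column
runCols : ℕ → ℕ → Tableau → InsResult
runCols zero    x T = makeNewRow x T
runCols (suc k) x T with scanCol k 1 x T
... | stopAt T′ i = placed T′ (i , suc (suc k))
... | goOn T′ y   = runCols k y T′

insert : Tableau → ℕ → InsResult
insert U b = runCols (maxLen U) b U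

resultTableau : InsResult → Tableau
resultTableau (placed T _) = T
resultTableau (newRow T _) = T

newBox : InsResult → Box
newBox (placed _ B) = B
newBox (newRow _ r) = (r , 1)

track : InsResult → Box → Box
track (placed _ _) B       = B
track (newRow _ r) (i , j) = (if r ≤ᵇ i then suc i else i) , j

-- successive insertions; returns the final tableau and the new boxes
-- B₁, …, Bₙ (in order of creation) regarded as boxes of the final tableau
insertAllFrom : Tableau → List Box → List ℕ → Tableau × List Box
insertAllFrom T Bs []       = T , Bs
insertAllFrom T Bs (b ∷ bs) =
  let R = insert T b in
  insertAllFrom (resultTableau R) (map (track R) Bs ++ [ newBox R ]) bs

insertAll : Tableau → List ℕ → Tableau × List Box
insertAll U bs = insertAllFrom U [] bs

module Submission where

-- By induction along the word it suffices to show,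
-- for two consecutive insertions x ≤ y, that the box of y precedes the
-- (tracked) box of x (`insert-in-order`).  Both insertions scan the columns
-- from right to left; comparing them column by column (`runCols-in-order`):
-- if x passes a column handing on x′, so does y, handing on some y′ ≥ x′
-- (`pass-then-pass`); if both stop in one column, y stops lower
-- (`stop-then-lower`); if only x stops, y ends further left; in the first
-- column y's new row lies below x's.  Since y scans a column after x has
-- also changed the columns left of it, we record what x may have done
-- there (`Change`: it only wrote values bounded by its hand) and that a scan
-- of columns 1,…,k+1 reads nothing else (`runCols-local`).

open import Defs
open import Data.Nat using (ℕ; zero; suc; _+_; _∸_; _≤_; _<_; _<ᵇ_; _≤ᵇ_; _≡ᵇ_; _≤?_; z≤n; s≤s)
open import Data.Nat.Properties
open import Data.Bool using (true; false; _∧_; if_then_else_)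
open import Data.List using (List; []; _∷_; _++_; length; map; [_])
open import Data.List.Properties using (map-++; length-++)
open import Data.List.Relation.Unary.All as All using (All; []; _∷_)
open import Data.List.Relation.Unary.Linked as Linked using (Linked; []; [-]; _∷_)
open import Data.List.Relation.Unary.Linked.Properties using (map⁺)
open import Data.List.Relation.Binary.Pointwise as Pointwise using (Pointwise; []; _∷_)
open import Data.Product using (_×_; _,_; proj₁; proj₂)
open import Data.Sum using (_⊎_; inj₁; inj₂)
open import Data.Empty using (⊥-elim)
open import Relation.Nullary using (¬_; yes; no)
open import Relation.Nullary.Reflects using (Reflects; ofʸ; ofⁿ; fromEquivalence; _×-reflects_)
open import Relation.Binary.PropositionalEquality using (_≡_; refl; sym; trans; cong; subst; module ≡-Reasoning)

length-set : ∀ r n y → length (set r n y) ≡ length r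
length-set []      n       y = refl
length-set (x ∷ r) zero    y = refl
length-set (x ∷ r) (suc n) y = cong suc (length-set r n y)

get-set-same : ∀ r n y → n < length r → get (set r n y) n ≡ y
get-set-same (x ∷ r) zero    y _       = refl
get-set-same (x ∷ r) (suc n) y (s≤s p) = get-set-same r n y p

get-set-other : ∀ r n m y → ¬ m ≡ n → get (set r n y) m ≡ get r m
get-set-other []      n       m       y _  = refl
get-set-other (x ∷ r) zero    zero    y ne = ⊥-elim (ne refl)
get-set-other (x ∷ r) zero    (suc m) y ne = refl
get-set-other (x ∷ r) (suc n) zero    y ne = refl
get-set-other (x ∷ r) (suc n) (suc m) y ne = get-set-other r n m y (λ e → ne (cong suc e))

length-snoc : ∀ (r : Row) x → length (r ++ [ x ]) ≡ suc (length r)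
length-snoc r x = trans (length-++ r) (+-comm (length r) 1)

get-snoc-last : ∀ (r : Row) x → get (r ++ [ x ]) (length r) ≡ x
get-snoc-last []      x = refl
get-snoc-last (a ∷ r) x = get-snoc-last r x

Placeable : ℕ → ℕ → Row → Set
Placeable c x r = length r ≡ suc c × x < get r c

Bumpable : ℕ → ℕ → Row → Set
Bumpable c x r = suc c < length r × get r (suc c) ≤ x × x < get r c

placeable-reflects : ∀ c x r →
  Reflects (Placeable c x r) ((length r ≡ᵇ suc c) ∧ (x <ᵇ get r c))
placeable-reflects c x r =
  fromEquivalence (≡ᵇ⇒≡ (length r) (suc c)) (≡⇒≡ᵇ (length r) (suc c))
  ×-reflects <ᵇ-reflects-< x (get r c)

bumpable-reflects : ∀ c x r →
  Reflects (Bumpable c x r) ((suc c <ᵇ length r) ∧ (get r (suc c) ≤ᵇ x) ∧ (x <ᵇ get r c))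
bumpable-reflects c x r =
  <ᵇ-reflects-< (suc c) (length r) ×-reflects ≤ᵇ-reflects-≤ (get r (suc c)) x
  ×-reflects <ᵇ-reflects-< x (get r c)

data Outcome : Set where
  stoppedAt : ℕ → Outcome
  passes    : ℕ → Outcome

scanTableau : ScanResult → Tableau
scanTableau (stopAt T _) = T
scanTableau (goOn T _)   = T

scanOutcome : ScanResult → Outcome
scanOutcome (stopAt _ i) = stoppedAt i
scanOutcome (goOn _ z)   = passes z

-- Scan c i x T T′ o: scanning column c+2 of T from row i down with x in hand
-- produces T′ and ends with o.
data Scan (c : ℕ) : ℕ → ℕ → Tableau → Tableau → Outcome → Set where
  end   : ∀ {i x} → Scan c i x [] [] (passes x)
  place : ∀ {i x r rs} → Placeable c x r →
          Scan c i x (r ∷ rs) ((r ++ [ x ]) ∷ rs) (stoppedAt i)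
  bump  : ∀ {i x r rs rs′ o} → ¬ Placeable c x r → Bumpable c x r →
          Scan c (suc i) (get r (suc c)) rs rs′ o →
          Scan c i x (r ∷ rs) (set r (suc c) x ∷ rs′) o
  skip  : ∀ {i x r rs rs′ o} → ¬ Placeable c x r → ¬ Bumpable c x r →
          Scan c (suc i) x rs rs′ o →
          Scan c i x (r ∷ rs) (r ∷ rs′) o

scanCol-spec : ∀ c i x T →
  Scan c i x T (scanTableau (scanCol c i x T)) (scanOutcome (scanCol c i x T))
scanCol-spec c i x [] = end
scanCol-spec c i x (r ∷ rs)
  with (length r ≡ᵇ suc c) ∧ (x <ᵇ get r c) | placeable-reflects c x r
... | true  | ofʸ p = place p
... | false | ofⁿ ¬p
  with (suc c <ᵇ length r) ∧ (get r (suc c) ≤ᵇ x) ∧ (x <ᵇ get r c) | bumpable-reflects c x r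
...   | true | ofʸ b
    with scanCol c (suc i) (get r (suc c)) rs | scanCol-spec c (suc i) (get r (suc c)) rs
...     | stopAt _ _ | s = bump ¬p b s
...     | goOn _ _   | s = bump ¬p b s
scanCol-spec c i x (r ∷ rs) | false | ofⁿ ¬p | false | ofⁿ ¬b
    with scanCol c (suc i) x rs | scanCol-spec c (suc i) x rs
...     | stopAt _ _ | s = skip ¬p ¬b s
...     | goOn _ _   | s = skip ¬p ¬b s

hand-decreases : ∀ {c i x T T′ z} → Scan c i x T T′ (passes z) → z ≤ x
hand-decreases end                      = ≤-refl
hand-decreases (bump _ (_ , v≤x , _) s) = ≤-trans (hand-decreases s) v≤x
hand-decreases (skip _ _ s)             = hand-decreases s

stops-below : ∀ {c i x T T′ n} → Scan c i x T T′ (stoppedAt n) → i ≤ n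
stops-below (place _)    = ≤-refl
stops-below (bump _ _ s) = ≤-trans (n≤1+n _) (stops-below s)
stops-below (skip _ _ s) = ≤-trans (n≤1+n _) (stops-below s)

record SameUpTo (k : ℕ) (r s : Row) : Set where
  constructor sameUpTo
  field
    same-length  : length r ≡ length s
    same-entries : ∀ n → n ≤ k → get r n ≡ get s n

Agree : ℕ → Tableau → Tableau → Set
Agree k = Pointwise (SameUpTo k)

sameUpTo-refl : ∀ {k} r → SameUpTo k r r
sameUpTo-refl r = sameUpTo refl (λ _ _ → refl)

sameUpTo-sym : ∀ {k r s} → SameUpTo k r s → SameUpTo k s r
sameUpTo-sym (sameUpTo l e) = sameUpTo (sym l) (λ n p → sym (e n p))

sameUpTo-trans : ∀ {k r s t} → SameUpTo k r s → SameUpTo k s t → SameUpTo k r t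
sameUpTo-trans (sameUpTo l e) (sameUpTo l′ e′) =
  sameUpTo (trans l l′) (λ n p → trans (e n p) (e′ n p))

sameUpTo-weaken : ∀ {k r s} → SameUpTo (suc k) r s → SameUpTo k r s
sameUpTo-weaken (sameUpTo l e) = sameUpTo l (λ n p → e n (m≤n⇒m≤1+n p))

set-sameUpTo : ∀ {c} r x → SameUpTo c (set r (suc c) x) r
set-sameUpTo {c} r x = sameUpTo (length-set r (suc c) x)
  (λ n p → get-set-other r (suc c) n x (λ e → <-irrefl e (s≤s p)))

pass-preserves : ∀ {c i x T T′ z} → Scan c i x T T′ (passes z) → Agree c T′ T
pass-preserves end                      = []
pass-preserves (bump {r = r} _ _ s)     = set-sameUpTo r _ ∷ pass-preserves s
pass-preserves (skip {r = r} _ _ s)     = sameUpTo-refl r ∷ pass-preserves s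

-- The conditions for column c+2 only read columns c+1 and c+2.
placeable-transport : ∀ {c x x′ r s} → x ≡ x′ → SameUpTo (suc c) r s →
                      Placeable c x r → Placeable c x′ s
placeable-transport {c} refl (sameUpTo l e) (len , x<) =
  trans (sym l) len , subst (_ <_) (e c (n≤1+n c)) x<

bumpable-transport : ∀ {c x x′ r s} → x ≡ x′ → SameUpTo (suc c) r s →
                     Bumpable c x r → Bumpable c x′ s
bumpable-transport {c} refl (sameUpTo l e) (wide , v≤x , x<) =
  subst (suc c <_) l wide , subst (_≤ _) (e (suc c) ≤-refl) v≤x , subst (_ <_) (e c (n≤1+n c)) x<

scan-outcome-local : ∀ {c i x x′ A B A′ B′ o o′} → x ≡ x′ → Agree (suc c) A B →
                     Scan c i x A A′ o → Scan c i x′ B B′ o′ → o ≡ o′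
scan-outcome-local e [] end end = cong passes e
scan-outcome-local e (_ ∷ _) (place _) (place _) = refl
scan-outcome-local e (ag ∷ _) (place p) (bump ¬p _ _) = ⊥-elim (¬p (placeable-transport e ag p))
scan-outcome-local e (ag ∷ _) (place p) (skip ¬p _ _) = ⊥-elim (¬p (placeable-transport e ag p))
scan-outcome-local e (ag ∷ _) (bump ¬p _ _) (place p) =
  ⊥-elim (¬p (placeable-transport (sym e) (sameUpTo-sym ag) p))
scan-outcome-local e (ag ∷ _) (skip ¬p _ _) (place p) =
  ⊥-elim (¬p (placeable-transport (sym e) (sameUpTo-sym ag) p))
scan-outcome-local {c} e (ag ∷ ags) (bump _ _ s) (bump _ _ s′) =
  scan-outcome-local (SameUpTo.same-entries ag (suc c) ≤-refl) ags s s′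
scan-outcome-local e (ag ∷ _) (bump _ b _) (skip _ ¬b _) = ⊥-elim (¬b (bumpable-transport e ag b))
scan-outcome-local e (ag ∷ _) (skip _ ¬b _) (bump _ b _) =
  ⊥-elim (¬b (bumpable-transport (sym e) (sameUpTo-sym ag) b))
scan-outcome-local e (_ ∷ ags) (skip _ _ s) (skip _ _ s′) = scan-outcome-local e ags s s′

lastLe-local : ∀ {y i acc A B} → Agree 0 A B → lastLe y i acc A ≡ lastLe y i acc B
lastLe-local [] = refl
lastLe-local (ag ∷ ags) rewrite SameUpTo.same-entries ag 0 z≤n = lastLe-local ags

footprint : InsResult → Box ⊎ ℕ
footprint (placed _ B) = inj₁ B
footprint (newRow _ r) = inj₂ r

runCols-local : ∀ k y A B → Agree k A B → footprint (runCols k y A) ≡ footprint (runCols k y B)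
runCols-local zero y A B ag = cong (λ p → inj₂ (suc p)) (lastLe-local ag)
runCols-local (suc k) y A B ag
  with scanCol k 1 y A | scanCol-spec k 1 y A | scanCol k 1 y B | scanCol-spec k 1 y B
... | stopAt _ _ | sa | stopAt _ _ | sb with scan-outcome-local refl ag sa sb
...   | refl = refl
runCols-local (suc k) y A B ag | stopAt _ _ | sa | goOn _ _ | sb
  with scan-outcome-local refl ag sa sb
...   | ()
runCols-local (suc k) y A B ag | goOn _ _ | sa | stopAt _ _ | sb
  with scan-outcome-local refl ag sa sb
...   | ()
runCols-local (suc k) y A B ag | goOn a z | sa | goOn b _ | sb
  with scan-outcome-local refl ag sa sb
...   | refl = runCols-local k z a b agree
  where
  agree : Agree k a b
  agree = Pointwise.transitive sameUpTo-trans (pass-preserves sa)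
            (Pointwise.transitive sameUpTo-trans (Pointwise.map sameUpTo-weaken ag)
              (Pointwise.symmetric sameUpTo-sym (pass-preserves sb)))

Bounded : ℕ → ℕ → Row → Row → Set
Bounded k w r r₁ = get r₁ k ≡ get r k ⊎ get r₁ k ≤ w

-- r₁ arises from r by changes in columns ≤ k+1 writing values ≤ w in column k+1.
record RowChange (k w : ℕ) (r r₁ : Row) : Set where
  constructor rowChange
  field
    wide : suc k < length r₁ →
           length r₁ ≡ length r × (∀ n → suc k ≤ n → get r₁ n ≡ get r n) × Bounded k w r r₁
    full : length r₁ ≡ suc k → (length r ≡ suc k × get r₁ k ≡ get r k) ⊎ get r₁ k ≤ w

record FreshRow (k w : ℕ) (r₁ : Row) : Set where
  constructor freshRow
  field
    fits   : length r₁ ≤ suc k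
    filled : length r₁ ≡ suc k → get r₁ k ≤ w

-- T₁ arises from T by passing a hand ≤ w through columns k+1, …, 1.
data Change (k w : ℕ) : Tableau → Tableau → Set where
  []    : Change k w [] []
  _∷_   : ∀ {r r₁ rs rs₁} → RowChange k w r r₁ → Change k w rs rs₁ →
          Change k w (r ∷ rs) (r₁ ∷ rs₁)
  fresh : ∀ {r₁ rs rs₁} → FreshRow k w r₁ → Change k w rs rs₁ → Change k w rs (r₁ ∷ rs₁)

unchanged-row : ∀ {k w} r → RowChange k w r r
unchanged-row r = rowChange (λ _ → refl , (λ _ _ → refl) , inj₁ refl) (λ l → inj₁ (l , refl))

no-change : ∀ {k w} T → Change k w T T
no-change []      = []
no-change (r ∷ T) = unchanged-row r ∷ no-change T

bump-change : ∀ {k w x} r → suc k < length r → x ≤ w → RowChange (suc k) w r (set r (suc k) x)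
bump-change {k} {w} {x} r wide x≤w = rowChange
  (λ _ → length-set r (suc k) x
       , (λ n p → get-set-other r (suc k) n x (λ e → <-irrefl (sym e) p))
       , inj₂ written)
  (λ _ → inj₂ written)
  where
  written : get (set r (suc k) x) (suc k) ≤ w
  written = subst (_≤ w) (sym (get-set-same r (suc k) x wide)) x≤w

place-change : ∀ {k w x} r → length r ≡ suc k → x ≤ w → RowChange (suc k) w r (r ++ [ x ])
place-change {k} {w} {x} r len x≤w = rowChange
  (λ p → ⊥-elim (<-irrefl (sym new-length) p))
  (λ _ → inj₂ (subst (_≤ w) (sym written) x≤w))
  where
  new-length : length (r ++ [ x ]) ≡ suc (suc k)
  new-length = trans (length-snoc r x) (cong suc len)
  written : get (r ++ [ x ]) (suc k) ≡ x
  written = subst (λ m → get (r ++ [ x ]) m ≡ x) len (get-snoc-last r x)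

scan-change : ∀ {k i x w T T′ o} → x ≤ w → Scan k i x T T′ o → Change (suc k) w T T′
scan-change x≤w end                                   = []
scan-change x≤w (place {r = r} {rs = rs} (len , _))   = place-change r len x≤w ∷ no-change rs
scan-change x≤w (bump {r = r} _ (wide , v≤x , _) s)   =
  bump-change r wide x≤w ∷ scan-change (≤-trans v≤x x≤w) s
scan-change x≤w (skip {r = r} _ _ s)                  = unchanged-row r ∷ scan-change x≤w s

-- Changes in columns ≤ k+1 do not affect column k+2 or the long rows' lengths,
-- so they compose with a change of column k+2.
rowChange-∘ : ∀ {k w w′ r r′ r₁} → RowChange (suc k) w r r′ → RowChange k w′ r′ r₁ →
              RowChange (suc k) w r r₁
rowChange-∘ {k} {w} {w′} {r} {r′} {r₁} (rowChange wide₁ full₁) (rowChange wide₂ _) =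
  rowChange wide full
  where
  wide : suc (suc k) < length r₁ → _
  wide p with wide₂ (<-trans (n<1+n (suc k)) p)
  ... | (l₂ , above₂ , _) with wide₁ (subst (suc (suc k) <_) l₂ p)
  ...   | (l₁ , above₁ , bound) =
    trans l₂ l₁ ,
    (λ n q → trans (above₂ n (≤-trans (n≤1+n (suc k)) q)) (above₁ n q)) ,
    subst (λ v → (v ≡ get r (suc k)) ⊎ (v ≤ w)) (sym (above₂ (suc k) ≤-refl)) bound
  full : length r₁ ≡ suc (suc k) → _
  full len with wide₂ (subst (suc k <_) (sym len) ≤-refl)
  ... | (l₂ , above₂ , _) with full₁ (trans (sym l₂) len)
  ...   | inj₁ (l , same) = inj₁ (l , trans (above₂ (suc k) ≤-refl) same)
  ...   | inj₂ bound      = inj₂ (subst (_≤ w) (sym (above₂ (suc k) ≤-refl)) bound)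

freshRow-∘ : ∀ {k w w′ r′ r₁} → FreshRow (suc k) w r′ → RowChange k w′ r′ r₁ →
             FreshRow (suc k) w r₁
freshRow-∘ {k} {w} {w′} {r′} {r₁} (freshRow fits filled) (rowChange wide _) =
  freshRow fits₁ filled₁
  where
  fits₁ : length r₁ ≤ suc (suc k)
  fits₁ with length r₁ ≤? suc (suc k)
  ... | yes p = p
  ... | no ¬p = ⊥-elim (¬p (subst (_≤ suc (suc k))
                  (sym (proj₁ (wide (<-trans (n<1+n (suc k)) (≰⇒> ¬p))))) fits))
  filled₁ : length r₁ ≡ suc (suc k) → get r₁ (suc k) ≤ w
  filled₁ len with wide (subst (suc k <_) (sym len) ≤-refl)
  ... | (l , above , _) = subst (_≤ w) (sym (above (suc k) ≤-refl)) (filled (trans (sym l) len))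

freshRow-widen : ∀ {k w w′ r₁} → FreshRow k w′ r₁ → FreshRow (suc k) w r₁
freshRow-widen {k} (freshRow fits _) =
  freshRow (m≤n⇒m≤1+n fits) (λ len → ⊥-elim (<-irrefl refl (subst (_≤ suc k) len fits)))

change-∘ : ∀ {k w w′ T T′ T₁} → Change (suc k) w T T′ → Change k w′ T′ T₁ → Change (suc k) w T T₁
change-∘ []              []         = []
change-∘ (ch ∷ chs)      (ch′ ∷ cs) = rowChange-∘ ch ch′ ∷ change-∘ chs cs
change-∘ (fresh new chs) (ch′ ∷ cs) = fresh (freshRow-∘ new ch′) (change-∘ chs cs)
change-∘ chs             (fresh new cs) = fresh (freshRow-widen new) (change-∘ chs cs)

newRow-change : ∀ x T p → Change 0 x T (insertAt T p [ x ])
newRow-change x T       zero    = fresh (freshRow ≤-refl (λ _ → ≤-refl)) (no-change T)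
newRow-change x []      (suc p) = fresh (freshRow ≤-refl (λ _ → ≤-refl)) []
newRow-change x (s ∷ T) (suc p) = unchanged-row s ∷ newRow-change x T p

runCols-change : ∀ k x T → Change k x T (resultTableau (runCols k x T))
runCols-change zero    x T = newRow-change x T (lastLe x 0 0 T)
runCols-change (suc k) x T with scanCol k 1 x T | scanCol-spec k 1 x T
... | stopAt _ _ | s = scan-change ≤-refl s
... | goOn T′ x′ | s = change-∘ (scan-change ≤-refl s) (runCols-change k x′ T′)

skipped-not-placeable : ∀ {k w h g r r₁} → ¬ Placeable k h r → w ≤ h → h ≤ g →
                        RowChange k w r r₁ → ¬ Placeable k g r₁
skipped-not-placeable ¬p w≤h h≤g ch (len , g<) with RowChange.full ch len
... | inj₁ (len₀ , same) = ¬p (len₀ , ≤-<-trans h≤g (subst (_ <_) same g<))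
... | inj₂ bound         = <⇒≱ g< (≤-trans bound (≤-trans w≤h h≤g))

skipped-bump-hand : ∀ {k w h g r r₁} → ¬ Bumpable k h r → w ≤ h → h ≤ g →
                    RowChange k w r r₁ → Bumpable k g r₁ → h ≤ get r₁ (suc k)
skipped-bump-hand {k} {h = h} {r = r} ¬b w≤h h≤g ch (wide , _ , g<)
  with RowChange.wide ch wide
... | (_ , _ , inj₂ bound) = ⊥-elim (<⇒≱ g< (≤-trans bound (≤-trans w≤h h≤g)))
... | (len , above , inj₁ same) rewrite above (suc k) ≤-refl with get r (suc k) ≤? h
...   | yes v≤h = ⊥-elim (¬b (subst (suc k <_) len wide , v≤h , ≤-<-trans h≤g (subst (_ <_) same g<)))
...   | no  v≰h = <⇒≤ (≰⇒> v≰h)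

bumped-not-placeable : ∀ {k w h g r r₁} → Bumpable k h r → w ≤ get r (suc k) → h ≤ g →
                       RowChange k w (set r (suc k) h) r₁ → ¬ Placeable k g r₁
bumped-not-placeable {k} {h = h} {r = r} (wide , v≤h , _) w≤v h≤g ch (len , g<)
  with RowChange.full ch len
... | inj₁ (len₀ , _) = <-irrefl (trans (sym len₀) (length-set r (suc k) h)) wide
... | inj₂ bound      = <⇒≱ g< (≤-trans bound (≤-trans w≤v (≤-trans v≤h h≤g)))

bumped-bump-hand : ∀ {k w h g r r₁} → Bumpable k h r → RowChange k w (set r (suc k) h) r₁ →
                   Bumpable k g r₁ → get r (suc k) ≤ get r₁ (suc k)
bumped-bump-hand {k} {h = h} {r = r} (wide , v≤h , _) ch (wide₁ , _ , _)
  with RowChange.wide ch wide₁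
... | (_ , above , _) =
  subst (get r (suc k) ≤_) (sym (trans (above (suc k) ≤-refl) (get-set-same r (suc k) h wide))) v≤h

data PassesAtLeast (x′ : ℕ) : Outcome → Set where
  passes≥ : ∀ {y′} → x′ ≤ y′ → PassesAtLeast x′ (passes y′)

pass-then-pass : ∀ {k i j x y x′ T T′ T₁ T₂ o} → Scan k i x T T′ (passes x′) →
                 Change k x′ T′ T₁ → x ≤ y → Scan k j y T₁ T₂ o → PassesAtLeast x′ o
pass-then-pass s₁ (fresh new _) x≤y (place (len , y<)) =
  ⊥-elim (<⇒≱ y< (≤-trans (FreshRow.filled new len) (≤-trans (hand-decreases s₁) x≤y)))
pass-then-pass s₁ (fresh new _) x≤y (bump _ (wide , _) _) = ⊥-elim (<⇒≱ wide (FreshRow.fits new))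
pass-then-pass s₁ (fresh _ chs) x≤y (skip _ _ s₂) = pass-then-pass s₁ chs x≤y s₂
pass-then-pass end [] x≤y end = passes≥ x≤y
pass-then-pass (skip ¬p _ s₁) (ch ∷ _) x≤y (place p) =
  ⊥-elim (skipped-not-placeable ¬p (hand-decreases s₁) x≤y ch p)
pass-then-pass (skip _ ¬b s₁) (ch ∷ chs) x≤y (bump _ b s₂) =
  pass-then-pass s₁ chs (skipped-bump-hand ¬b (hand-decreases s₁) x≤y ch b) s₂
pass-then-pass (skip _ _ s₁) (_ ∷ chs) x≤y (skip _ _ s₂) = pass-then-pass s₁ chs x≤y s₂
pass-then-pass (bump _ b s₁) (ch ∷ _) x≤y (place p) =
  ⊥-elim (bumped-not-placeable b (hand-decreases s₁) x≤y ch p)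
pass-then-pass (bump _ b s₁) (ch ∷ chs) x≤y (bump _ b₂ s₂) =
  pass-then-pass s₁ chs (bumped-bump-hand b ch b₂) s₂
pass-then-pass (bump _ (_ , v≤x , _) s₁) (_ ∷ chs) x≤y (skip _ _ s₂) =
  pass-then-pass s₁ chs (≤-trans v≤x x≤y) s₂

stop-then-lower : ∀ {k i x y T T′ T″ n n′} → Scan k i x T T′ (stoppedAt n) → x ≤ y →
                  Scan k i y T′ T″ (stoppedAt n′) → n < n′
stop-then-lower {k} {x = x} (place {r = r} (len , _)) _ (place (len′ , _)) =
  ⊥-elim (<-irrefl (trans (sym len′) (trans (length-snoc r x) (cong suc len))) ≤-refl)
stop-then-lower (place _) _ (bump _ _ s₂) = stops-below s₂
stop-then-lower (place _) _ (skip _ _ s₂) = stops-below s₂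
stop-then-lower (bump {r = r} _ b _) x≤y (place p) =
  ⊥-elim (bumped-not-placeable b z≤n x≤y (unchanged-row (set r _ _)) p)
stop-then-lower (bump {r = r} _ b s₁) _ (bump _ b₂ s₂) =
  stop-then-lower s₁ (bumped-bump-hand {w = 0} b (unchanged-row (set r _ _)) b₂) s₂
stop-then-lower (bump _ (_ , v≤x , _) s₁) x≤y (skip _ _ s₂) = stop-then-lower s₁ (≤-trans v≤x x≤y) s₂
stop-then-lower (skip {r = r} ¬p _ _) x≤y (place p) =
  ⊥-elim (skipped-not-placeable ¬p z≤n x≤y (unchanged-row r) p)
stop-then-lower (skip {r = r} _ ¬b s₁) x≤y (bump _ b s₂) =
  stop-then-lower s₁ (skipped-bump-hand ¬b z≤n x≤y (unchanged-row r) b) s₂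
stop-then-lower (skip _ _ s₁) x≤y (skip _ _ s₂) = stop-then-lower s₁ x≤y s₂

lastLe-≥-acc : ∀ y i acc T → acc ≤ i → acc ≤ lastLe y i acc T
lastLe-≥-acc y i acc []      acc≤i = ≤-refl
lastLe-≥-acc y i acc (r ∷ T) acc≤i with get r 0 ≤ᵇ y
... | true  = ≤-trans (m≤n⇒m≤1+n acc≤i) (lastLe-≥-acc y (suc i) (suc i) T ≤-refl)
... | false = lastLe-≥-acc y (suc i) acc T (m≤n⇒m≤1+n acc≤i)

lastLe-≤ : ∀ y i acc T → acc ≤ i → lastLe y i acc T ≤ i + length T
lastLe-≤ y i acc []      acc≤i = subst (acc ≤_) (sym (+-identityʳ i)) acc≤i
lastLe-≤ y i acc (r ∷ T) acc≤i with get r 0 ≤ᵇ y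
... | true  = subst (lastLe y (suc i) (suc i) T ≤_) (sym (+-suc i (length T)))
                (lastLe-≤ y (suc i) (suc i) T ≤-refl)
... | false = subst (lastLe y (suc i) acc T ≤_) (sym (+-suc i (length T)))
                (lastLe-≤ y (suc i) acc T (m≤n⇒m≤1+n acc≤i))

lastLe-after-insert : ∀ y x i acc T p → p ≤ length T → x ≤ y → acc ≤ i →
                      suc (i + p) ≤ lastLe y i acc (insertAt T p [ x ])
lastLe-after-insert y x i acc T zero _ x≤y _ with x ≤ᵇ y | ≤ᵇ-reflects-≤ x y
... | true  | _      = subst (_≤ lastLe y (suc i) (suc i) T) (cong suc (sym (+-identityʳ i)))
                         (lastLe-≥-acc y (suc i) (suc i) T ≤-refl)
... | false | ofⁿ ¬p = ⊥-elim (¬p x≤y)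
lastLe-after-insert y x i acc (s ∷ T) (suc p) (s≤s p≤) x≤y acc≤i with get s 0 ≤ᵇ y
... | true  = subst (λ m → suc m ≤ lastLe y (suc i) (suc i) (insertAt T p [ x ])) (sym (+-suc i p))
                (lastLe-after-insert y x (suc i) (suc i) T p p≤ x≤y ≤-refl)
... | false = subst (λ m → suc m ≤ lastLe y (suc i) acc (insertAt T p [ x ])) (sym (+-suc i p))
                (lastLe-after-insert y x (suc i) acc T p p≤ x≤y (m≤n⇒m≤1+n acc≤i))

InOrder : InsResult → InsResult → Set
InOrder R₁ R₂ = newBox R₂ <col track R₂ (newBox R₁)

in-order-transfer : ∀ {R₁ R₂ R₂′} → footprint R₂ ≡ footprint R₂′ → InOrder R₁ R₂′ → InOrder R₁ R₂
in-order-transfer {R₂ = placed _ _} {placed _ _} refl ord = ord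
in-order-transfer {R₂ = newRow _ _} {newRow _ _} refl ord = ord

-- Two new rows: the later one lies strictly lower and does not move the earlier one.
new-rows-in-order : ∀ T₁ T₂ p q → p < q → InOrder (newRow T₁ (suc p)) (newRow T₂ (suc q))
new-rows-in-order _ _ p q p<q with suc q ≤ᵇ suc p | ≤ᵇ-reflects-≤ (suc q) (suc p)
... | true  | ofʸ q≤p = ⊥-elim (<⇒≱ (s≤s p<q) q≤p)
... | false | _       = inj₂ (refl , s≤s p<q)

left-column-first : ∀ R {B B′} → proj₂ B′ < proj₂ B → B′ <col track R B
left-column-first (placed _ _) left = inj₁ left
left-column-first (newRow _ _) left = inj₁ left

newBox-column-≤ : ∀ k y T → proj₂ (newBox (runCols k y T)) ≤ suc k
newBox-column-≤ zero    y T = ≤-refl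
newBox-column-≤ (suc k) y T with scanCol k 1 y T
... | stopAt _ _ = ≤-refl
... | goOn T′ z  = m≤n⇒m≤1+n (newBox-column-≤ k z T′)

runCols-in-order : ∀ k x y T → x ≤ y →
                   InOrder (runCols k x T) (runCols k y (resultTableau (runCols k x T)))
runCols-in-order zero x y T x≤y =
  new-rows-in-order T₁ T₂ p q (lastLe-after-insert y x 0 0 T p (lastLe-≤ x 0 0 T z≤n) x≤y z≤n)
  where
  p q : ℕ
  T₁ T₂ : Tableau
  p  = lastLe x 0 0 T
  T₁ = insertAt T p [ x ]
  q  = lastLe y 0 0 T₁
  T₂ = insertAt T₁ q [ y ]
runCols-in-order (suc k) x y T x≤y with scanCol k 1 x T | scanCol-spec k 1 x T
... | stopAt T′ i | s₁ with scanCol k 1 y T′ | scanCol-spec k 1 y T′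
...   | stopAt _ _ | s₂ = inj₂ (refl , stop-then-lower s₁ x≤y s₂)
...   | goOn T″ y′ | _  = left-column-first (runCols k y′ T″) (s≤s (newBox-column-≤ k y′ T″))
runCols-in-order (suc k) x y T x≤y | goOn T′ x′ | s₁
  with scanCol k 1 y (resultTableau (runCols k x′ T′))
     | scanCol-spec k 1 y (resultTableau (runCols k x′ T′))
... | stopAt _ _ | s₂ with pass-then-pass s₁ (runCols-change k x′ T′) x≤y s₂
...   | ()
runCols-in-order (suc k) x y T x≤y | goOn T′ x′ | s₁ | goOn T″ y′ | s₂
  with pass-then-pass s₁ (runCols-change k x′ T′) x≤y s₂
...   | passes≥ x′≤y′ =
  in-order-transfer {runCols k x′ T′} {R₂′ = runCols k y′ T₁} (runCols-local k y′ T″ T₁ (pass-preserves s₂))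
    (runCols-in-order k x′ y′ T′ x′≤y′)
  where
  T₁ : Tableau
  T₁ = resultTableau (runCols k x′ T′)

scan-beyond : ∀ {k i y T T′ o} → All (λ r → length r ≤ k) T → Scan k i y T T′ o →
              T′ ≡ T × o ≡ passes y
scan-beyond []          end                    = refl , refl
scan-beyond {k} (r≤k ∷ _) (place (len , _))      = ⊥-elim (<-irrefl refl (subst (_≤ k) len r≤k))
scan-beyond (r≤k ∷ _)   (bump _ (wide , _) _)  = ⊥-elim (<⇒≱ wide (m≤n⇒m≤1+n r≤k))
scan-beyond (_ ∷ short) (skip _ _ s) with scan-beyond short s
... | refl , refl = refl , refl

runCols-beyond : ∀ d {k y T} → All (λ r → length r ≤ k) T → runCols (d + k) y T ≡ runCols k y T
runCols-beyond zero         short = refl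
runCols-beyond (suc d) {k} {y} {T} short with scanCol (d + k) 1 y T | scanCol-spec (d + k) 1 y T
... | stopAt _ _ | s with scan-beyond (All.map (λ r≤k → ≤-trans r≤k (m≤n+m k d)) short) s
...   | _ , ()
runCols-beyond (suc d) {k} {y} {T} short | goOn _ _ | s
  with scan-beyond (All.map (λ r≤k → ≤-trans r≤k (m≤n+m k d)) short) s
...   | refl , refl = runCols-beyond d short

rows-≤-maxLen : ∀ T → All (λ r → length r ≤ maxLen T) T
rows-≤-maxLen []      = []
rows-≤-maxLen (r ∷ T) =
  m≤m⊔n (length r) (maxLen T) ∷ All.map (λ p → ≤-trans p (m≤n⊔m (length r) (maxLen T))) (rows-≤-maxLen T)

maxLen-≤ : ∀ {k} T → All (λ r → length r ≤ k) T → maxLen T ≤ k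
maxLen-≤ []      []       = z≤n
maxLen-≤ (r ∷ T) (p ∷ ps) = ⊔-lub p (maxLen-≤ T ps)

insert-as-runCols : ∀ {k} T y → maxLen T ≤ k → insert T y ≡ runCols k y T
insert-as-runCols {k} T y m≤k = sym (begin
  runCols k y T                            ≡⟨ cong (λ n → runCols n y T) (sym (m∸n+n≡m m≤k)) ⟩
  runCols (k ∸ maxLen T + maxLen T) y T    ≡⟨ runCols-beyond (k ∸ maxLen T) (rows-≤-maxLen T) ⟩
  runCols (maxLen T) y T                   ∎)
  where open ≡-Reasoning

change-lengths : ∀ {k w T T₁} → All (λ r → length r ≤ k) T → Change k w T T₁ →
                 All (λ r → length r ≤ suc k) T₁
change-lengths []            []                = []
change-lengths {k} (r≤k ∷ short) (_∷_ {r₁ = r₁} ch chs) = r₁≤ ∷ change-lengths short chs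
  where
  r₁≤ : length r₁ ≤ suc k
  r₁≤ with length r₁ ≤? suc k
  ... | yes p = p
  ... | no ¬p = ⊥-elim (¬p (m≤n⇒m≤1+n (subst (_≤ k) (sym (proj₁ (RowChange.wide ch (≰⇒> ¬p)))) r≤k)))
change-lengths short         (fresh new chs)   = FreshRow.fits new ∷ change-lengths short chs

insert-in-order : ∀ U b b′ → b ≤ b′ → InOrder (insert U b) (insert (resultTableau (insert U b)) b′)
insert-in-order U b b′ b≤b′ =
  subst (InOrder (insert U b)) (sym second-start)
    (subst (λ R → InOrder R (runCols (suc m) b′ (resultTableau R))) first-start
      (runCols-in-order (suc m) b b′ U b≤b′))
  where
  m : ℕ
  m = maxLen U
  T₁ : Tableau
  T₁ = resultTableau (insert U b)
  first-start : runCols (suc m) b U ≡ insert U b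
  first-start = sym (insert-as-runCols U b (n≤1+n m))
  second-start : insert T₁ b′ ≡ runCols (suc m) b′ T₁
  second-start = insert-as-runCols T₁ b′
    (maxLen-≤ T₁ (change-lengths (rows-≤-maxLen U) (runCols-change m b U)))

_>col_ : Box → Box → Set
B >col B′ = B′ <col B

track-monotone : ∀ R {B B′} → B >col B′ → track R B >col track R B′
track-monotone (placed _ _) before = before
track-monotone (newRow _ r) {i , j} {i′ , j′} (inj₁ left) = inj₁ left
track-monotone (newRow _ r) {i , j} {i′ , .j} (inj₂ (refl , lower)) = inj₂ (refl , shift-mono lower)
  where
  shift-mono : i < i′ → (if r ≤ᵇ i then suc i else i) < (if r ≤ᵇ i′ then suc i′ else i′)
  shift-mono i<i′ with r ≤ᵇ i | ≤ᵇ-reflects-≤ r i | r ≤ᵇ i′ | ≤ᵇ-reflects-≤ r i′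
  ... | true  | _        | true  | _         = s≤s i<i′
  ... | true  | ofʸ r≤i  | false | ofⁿ r≰i′  = ⊥-elim (r≰i′ (≤-trans r≤i (<⇒≤ i<i′)))
  ... | false | _        | true  | _         = m<n⇒m<1+n i<i′
  ... | false | _        | false | _         = i<i′

linked-snoc : ∀ {A : Set} {R : A → A → Set} xs a b →
              Linked R (xs ++ [ a ]) → R a b → Linked R ((xs ++ [ a ]) ++ [ b ])
linked-snoc []           a b _            Rab = Rab ∷ [-]
linked-snoc (x ∷ [])     a b (Rxa ∷ [-])  Rab = Rxa ∷ Rab ∷ [-]
linked-snoc (x ∷ y ∷ xs) a b (Rxy ∷ rest) Rab = Rxy ∷ linked-snoc (y ∷ xs) a b rest Rab

insertAllFrom-ordered : ∀ T₀ b₀ Bs bs → Linked _≤_ (b₀ ∷ bs) →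
  Linked _>col_ (Bs ++ [ newBox (insert T₀ b₀) ]) →
  Linked _>col_ (proj₂ (insertAllFrom (resultTableau (insert T₀ b₀)) (Bs ++ [ newBox (insert T₀ b₀) ]) bs))
insertAllFrom-ordered T₀ b₀ Bs []       _                  ordered = ordered
insertAllFrom-ordered T₀ b₀ Bs (b ∷ bs) (b₀≤b ∷ increasing) ordered =
  insertAllFrom-ordered T₁ b (map (track R) (Bs ++ [ B ])) bs increasing ordered′
  where
  T₁ : Tableau
  T₁ = resultTableau (insert T₀ b₀)
  B : Box
  B = newBox (insert T₀ b₀)
  R : InsResult
  R = insert T₁ b
  tracked : Linked _>col_ (map (track R) Bs ++ [ track R B ])
  tracked = subst (Linked _>col_) (map-++ (track R) Bs [ B ])
              (map⁺ (Linked.map (track-monotone R) ordered))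
  ordered′ : Linked _>col_ (map (track R) (Bs ++ [ B ]) ++ [ newBox R ])
  ordered′ = subst (λ Bs′ → Linked _>col_ (Bs′ ++ [ newBox R ])) (sym (map-++ (track R) Bs [ B ]))
               (linked-snoc (map (track R) Bs) (track R B) (newBox R) tracked
                 (insert-in-order T₀ b₀ b b₀≤b))

mainTheorem6 : (U : Tableau) → IsRCT U → (bs : List ℕ) →
               All (λ b → 1 ≤ b) bs → Linked _≤_ bs →
               Linked (λ B B′ → B′ <col B) (proj₂ (insertAll U bs))
mainTheorem6 U _ []       _ _          = []
mainTheorem6 U _ (b ∷ bs) _ increasing = insertAllFrom-ordered U b [] bs increasing [-]
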